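{- Let $k\ge 1$ and let $b=(b_1,\dots,b_k)$ be a sequence of positive integers whose multiset of values is $$\{b_1,\dots,b_k\}=\{\underbrace{a_s,\dots,a_s}_{m_s},\underbrace{a_{s-1},\dots,a_{s-1}}_{m_{s-1}},\dots,\underbrace{a_1,\dots,a_1}_{m_1}\}$$ with $a_s>a_{s-1}>\dots>a_1$ and $m_i\ge 1$. For $x=(x_1,\dots,x_k)^T\in\mathbb{R}^k$ let $$q(x)=\frac{1}{2}\sum_{i=1}^k\sum_{j=1}^k|i-j|\,x_ix_j .$$ Suppose $a_s>\sum_{i=1}^{s-1}m_ia_i$ and $m_s=2h+1$ for some integer $h\ge 0$. Then, among all vectors $x$ obtained by arranging $b_1,\dots,b_k$ in some order, $q(x)$ is maximized, uniquely up to reversal of the order of the entries, by $$x=(\underbrace{a_s,\dots,a_s}_{h+1},\underbrace{a_1,\dots,a_1}_{m_1},\underbrace{a_2,\dots,a_2}_{m_2},\dots,\underbrace{a_{s-1},\dots,a_{s-1}}_{m_{s-1}},\underbrace{a_s,\dots,a_s}_{h}).$$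
   Context: The sequence $b$ arises as the decremented degree sequence $(d_1-1,\dots,d_k-1)$ of the non-leaf vertices of a tree; $q(x)$ equals $W(T)-(n-1)^2$ for the caterpillar $T$ on $n$ vertices whose spine vertices $v_1,\dots,v_k$ (in order) have degrees $x_i+1$, where $W(T)$ is the Wiener index (sum of distances over all unordered vertex pairs). -}

module Defs where

open import Data.Nat using (ℕ; zero; suc; _+_; _*_; ∣_-_∣; _/_)
open import Data.Fin using (Fin)
open import Data.Nat.ListAction using (sum)
open import Data.List using (List; []; _∷_; map; zip; upTo; length; replicate; concatMap; allFin)
open import Data.Product using (_×_; _,_)

-- blocks n a m = a₁,…,a₁ (m₁ times), a₂,…(m₂ times), …, aₙ,…,aₙ (mₙ times)
-- (index i : Fin n stands for the paper's index i+1)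
blocks : (n : ℕ) → (Fin n → ℕ) → (Fin n → ℕ) → List ℕ
blocks n a m = concatMap (λ i → replicate (m i) (a i)) (allFin n)

indexed : List ℕ → List (ℕ × ℕ)
indexed x = zip (upTo (length x)) x

twiceQ : List ℕ → ℕ
twiceQ x = sum (map (λ { (i , xi) → sum (map (λ { (j , xj) → ∣ i - j ∣ * xi * xj }) (indexed x)) }) (indexed x))

-- q x = (1/2) Σ_i Σ_j |i-j| x_i x_j  (the double sum is even, so ℕ-division by 2 is exact)
q : List ℕ → ℕ
q x = twiceQ x / 2

module Submission where

-- Write S for the total and P₁, …, P_{k-1} for the prefix sums. Then q(x) = Σᵢ Pᵢ (S − Pᵢ): each cut
-- of the sequence contributes (sum on its left)·(sum on its right), and p(S − p) is concave and
-- symmetric about S/2. With one copy of the largest value M > Σ (rest), moving M to the end on its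
-- lighter side helps; once M is first, every later prefix sum exceeds S/2, where p(S − p) decreases,
-- so the other entries must follow in increasing order. With 2h + 3 copies of M, an arrangement whose
-- first entry e is not M strictly improves by exchanging e with the first M (everything in between
-- sums to less than M), and symmetrically at the end; an arrangement M y M has
-- q = M (|y| + 1)(Σ y + M) + q(y), which reduces h by one.

open import Defs
open import Data.Nat using (ℕ; suc; _+_; _*_; _≤_; _<_)
open import Data.Fin using (Fin; fromℕ; inject₁) renaming (_<_ to _<ᶠ_)
open import Data.Nat.ListAction using (sum)
open import Data.List using (List; length; map; replicate; allFin; _++_; reverse)
open import Data.List.Relation.Unary.All using (All)
open import Data.List.Relation.Binary.Permutation.Propositional using (_↭_)
open import Data.Product using (_×_)
open import Data.Sum using (_⊎_)
open import Relation.Binary.PropositionalEquality using (_≡_)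

open import Data.Empty using (⊥-elim)
import Data.Fin as Fin
open import Data.Fin.Properties using (toℕ-inject₁)
open import Data.List using ([]; _∷_; [_]; _∷ʳ_; zip; applyUpTo; filter; concat)
open import Data.List.Membership.Propositional using (_∈_)
open import Data.List.Membership.Propositional.Properties using (∈-∃++; ∈-++⁺ʳ)
open import Data.List.Properties
  using ( map-tabulate; unfold-reverse; length-reverse; reverse-involutive; reverse-injective; reverse-++
        ; ++-assoc; ++-identityʳ; ∷ʳ-++; filter-++; filter-all; filter-none)
open import Data.List.Relation.Binary.Permutation.Propositional
  using (↭-sym; ↭-trans; ↭-refl; ↭-prep; ↭-swap; ↭-reflexive)
open import Data.List.Relation.Binary.Permutation.Propositional.Properties
  using (↭-empty-inv; ∈-resp-↭; All-resp-↭; drop-mid; drop-∷; shift; shifts; ↭-length; ↭-reverse; filter-↭)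
open import Data.List.Relation.Unary.All as All using ([]; _∷_)
open import Data.List.Relation.Unary.All.Properties using (++⁺; ++⁻ˡ; replicate⁺)
open import Data.List.Relation.Unary.AllPairs using (AllPairs; []; _∷_)
import Data.List.Relation.Unary.AllPairs.Properties as AllPairs
open import Data.List.Relation.Unary.Any using (here; there)
-- The view constructor _++_∷_ is renamed, as in scope it would make every A ++ x ∷ B ambiguous.
open import Data.List.Relation.Unary.First using (FirstView; refine; fromAny) renaming (_++_∷_ to splitAt)
open import Data.List.Relation.Unary.First.Properties using (toView)
open import Data.Nat using (zero; _∸_; ∣_-_∣; _/_; s≤s; z<s; _≟_; _≤?_)
open import Data.Nat.DivMod using (m*n/n≡m)
open import Data.Nat.ListAction.Properties using (sum-++; sum-↭)
open import Data.Nat.Properties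
open import Algebra.Properties.CommutativeSemigroup +-commutativeSemigroup using (xy∙z≈xz∙y)
open import Data.Nat.Tactic.RingSolver using (solve-∀)
open import Data.Product using (_,_; proj₁; proj₂)
open import Data.Sum using (inj₁; inj₂)
open import Function using (_∘_)
open import Relation.Binary.PropositionalEquality
  using (_≢_; refl; sym; trans; cong; cong₂; subst; subst₂; module ≡-Reasoning)
open import Relation.Nullary using (¬_; ¬?; Dec; yes; no)
open import Relation.Unary using (Decidable)

sum-++ˡ-≤ : ∀ xs ys → sum xs ≤ sum (xs ++ ys)
sum-++ˡ-≤ xs ys = ≤-trans (m≤m+n (sum xs) (sum ys)) (≤-reflexive (sym (sum-++ xs ys)))

∈⇒≤sum : ∀ {v xs} → v ∈ xs → v ≤ sum xs
∈⇒≤sum {xs = y ∷ ys} (here refl) = m≤m+n y (sum ys)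
∈⇒≤sum {xs = y ∷ ys} (there v∈) = ≤-trans (∈⇒≤sum v∈) (m≤n+m (sum ys) y)

sum-replicate : ∀ n v → sum (replicate n v) ≡ n * v
sum-replicate zero    v = refl
sum-replicate (suc n) v = cong (v +_) (sum-replicate n v)

replicate-+ : ∀ m n (v : ℕ) → replicate (m + n) v ≡ replicate m v ++ replicate n v
replicate-+ zero    n v = refl
replicate-+ (suc m) n v = cong (v ∷_) (replicate-+ m n v)

replicate-∷ʳ : ∀ n (v : ℕ) → replicate (suc n) v ≡ replicate n v ∷ʳ v
replicate-∷ʳ zero    v = refl
replicate-∷ʳ (suc n) v = cong (v ∷_) (replicate-∷ʳ n v)

replicate-sorted : ∀ n v → AllPairs _≤_ (replicate n v)
replicate-sorted zero    v = []
replicate-sorted (suc n) v = replicate⁺ n ≤-refl ∷ replicate-sorted n v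

reverse-wrap : ∀ (M : ℕ) z → reverse (M ∷ (z ∷ʳ M)) ≡ M ∷ (reverse z ∷ʳ M)
reverse-wrap M z = trans (unfold-reverse M (z ∷ʳ M)) (cong (_∷ʳ M) (reverse-++ z [ M ]))

swap-↭ : ∀ (x y : ℕ) A C → x ∷ A ++ y ∷ C ↭ y ∷ A ++ x ∷ C
swap-↭ x y A C = ↭-trans (↭-prep x (shift y A C)) (↭-trans (↭-swap x y ↭-refl) (↭-prep y (↭-sym (shift x A C))))

drop-∷ʳ : ∀ {v : ℕ} xs ys → xs ∷ʳ v ↭ ys ∷ʳ v → xs ↭ ys
drop-∷ʳ xs ys p = subst₂ _↭_ (++-identityʳ xs) (++-identityʳ ys) (drop-mid xs ys p)

∈-tail : ∀ {v e : ℕ} {w ys} → v ≢ e → e ∷ w ↭ v ∷ ys → v ∈ w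
∈-tail v≢e p with ∈-resp-↭ (↭-sym p) (here refl)
... | here v≡e = ⊥-elim (v≢e v≡e)
... | there v∈w = v∈w

firstOccurrence : ∀ {v xs} → v ∈ xs → FirstView (v ≢_) (v ≡_) xs
firstOccurrence {v} v∈xs = toView (refine (λ {y} _ → decide (v ≟ y)) (fromAny v∈xs))
  where
  decide : ∀ {y} → Dec (v ≡ y) → v ≡ y ⊎ v ≢ y
  decide (yes v≡y) = inj₁ v≡y
  decide (no v≢y)  = inj₂ v≢y

-- q as a sum over cuts

-- cutSum T o x adds cutProduct T over the prefix sums of x shifted by o. For o = 0 and T = sum x
-- there is one term per cut after an entry of x, namely (sum left of it)·(sum right of it).
cutProduct : ℕ → ℕ → ℕ
cutProduct T p = p * (T ∸ p)

cutSum : ℕ → ℕ → List ℕ → ℕ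
cutSum T o []       = 0
cutSum T o (y ∷ ys) = cutProduct T (o + y) + cutSum T (o + y) ys

cutQ : List ℕ → ℕ
cutQ x = cutSum (sum x) 0 x

-- moment x = Σⱼ (j + 1) xⱼ
moment : List ℕ → ℕ
moment []       = 0
moment (y ∷ ys) = y + sum ys + moment ys

cutProduct-≡ : ∀ {T} p w → T ≡ p + w → cutProduct T p ≡ p * w
cutProduct-≡ p w refl = cong (p *_) (m+n∸m≡n p w)

cutQ-at : ∀ {T} x → sum x ≡ T → cutQ x ≡ cutSum T 0 x
cutQ-at x refl = refl

cutSum-++ : ∀ T o xs ys → cutSum T o (xs ++ ys) ≡ cutSum T o xs + cutSum T (o + sum xs) ys
cutSum-++ T o []       ys = cong (λ o′ → cutSum T o′ ys) (sym (+-identityʳ o))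
cutSum-++ T o (x ∷ xs) ys rewrite cutSum-++ T (o + x) xs ys | +-assoc o x (sum xs) =
  sym (+-assoc (cutProduct T (o + x)) (cutSum T (o + x) xs) _)

cutSum-shift : ∀ o p ys {T} → T ≡ p + sum ys →
               cutSum (o + T) (o + p) ys + o * sum ys ≡ o * moment ys + cutSum T p ys
cutSum-shift o p []       eq = sym (+-identityʳ (o * 0))
cutSum-shift o p (y ∷ ys) {T} eq rewrite +-assoc o p y = begin
    cutProduct (o + T) (o + r) + cutSum (o + T) (o + r) ys + o * (y + s)
  ≡⟨ cong (λ c → c + cutSum (o + T) (o + r) ys + o * (y + s))
       (cutProduct-≡ (o + r) s (trans (cong (o +_) eq′) (sym (+-assoc o r s)))) ⟩
    (o + r) * s + cutSum (o + T) (o + r) ys + o * (y + s)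
  ≡⟨ ring₁ o r s y (cutSum (o + T) (o + r) ys) ⟩
    (o + r) * s + o * y + (cutSum (o + T) (o + r) ys + o * s)
  ≡⟨ cong ((o + r) * s + o * y +_) (cutSum-shift o r ys eq′) ⟩
    (o + r) * s + o * y + (o * moment ys + cutSum T r ys)
  ≡⟨ ring₂ o r s y (moment ys) (cutSum T r ys) ⟩
    o * (y + s + moment ys) + (r * s + cutSum T r ys)
  ≡⟨ cong (λ c → o * (y + s + moment ys) + (c + cutSum T r ys)) (sym (cutProduct-≡ r s eq′)) ⟩
    o * (y + s + moment ys) + (cutProduct T r + cutSum T r ys)
  ∎
  where
  open ≡-Reasoning
  r s : ℕ
  r = p + y
  s = sum ys
  eq′ : T ≡ r + s
  eq′ = trans eq (sym (+-assoc p y s))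
  ring₁ : ∀ o r s y c → (o + r) * s + c + o * (y + s) ≡ (o + r) * s + o * y + (c + o * s)
  ring₁ = solve-∀
  ring₂ : ∀ o r s y m c → (o + r) * s + o * y + (o * m + c) ≡ o * (y + s + m) + (r * s + c)
  ring₂ = solve-∀

cutQ-∷ : ∀ y ys → cutQ (y ∷ ys) ≡ y * moment ys + cutQ ys
cutQ-∷ y ys = begin
    cutProduct (y + sum ys) y + cutSum (y + sum ys) y ys
  ≡⟨ cong₂ _+_ (cutProduct-≡ y (sum ys) refl) (cong (λ o → cutSum (y + sum ys) o ys) (sym (+-identityʳ y))) ⟩
    y * sum ys + cutSum (y + sum ys) (y + 0) ys
  ≡⟨ +-comm (y * sum ys) _ ⟩
    cutSum (y + sum ys) (y + 0) ys + y * sum ys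
  ≡⟨ cutSum-shift y 0 ys refl ⟩
    y * moment ys + cutQ ys
  ∎
  where open ≡-Reasoning

moment-∷ʳ : ∀ ys y → moment (ys ∷ʳ y) ≡ moment ys + suc (length ys) * y
moment-∷ʳ []       y = +-identityʳ (y + 0)
moment-∷ʳ (z ∷ zs) y = begin
    z + sum (zs ∷ʳ y) + moment (zs ∷ʳ y)
  ≡⟨ cong₂ (λ s m → z + s + m) (sum-++ zs [ y ]) (moment-∷ʳ zs y) ⟩
    z + (sum zs + (y + 0)) + (moment zs + suc (length zs) * y)
  ≡⟨ ring z (sum zs) y (moment zs) (length zs) ⟩
    z + sum zs + moment zs + suc (suc (length zs)) * y
  ∎
  where
  open ≡-Reasoning
  ring : ∀ z s y m n → z + (s + (y + 0)) + (m + suc n * y) ≡ z + s + m + suc (suc n) * y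
  ring = solve-∀

moment-reverse-∷ : ∀ z zs → moment (reverse (z ∷ zs)) ≡ moment (reverse zs) + suc (length zs) * z
moment-reverse-∷ z zs = begin
    moment (reverse (z ∷ zs))                           ≡⟨ cong moment (unfold-reverse z zs) ⟩
    moment (reverse zs ∷ʳ z)                            ≡⟨ moment-∷ʳ (reverse zs) z ⟩
    moment (reverse zs) + suc (length (reverse zs)) * z ≡⟨ cong (λ n → moment (reverse zs) + suc n * z) (length-reverse zs) ⟩
    moment (reverse zs) + suc (length zs) * z           ∎
  where open ≡-Reasoning

moment+moment-reverse : ∀ ys → moment ys + moment (reverse ys) ≡ suc (length ys) * sum ys
moment+moment-reverse []       = refl
moment+moment-reverse (z ∷ zs) = begin
    z + sum zs + moment zs + moment (reverse (z ∷ zs))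
  ≡⟨ cong (z + sum zs + moment zs +_) (moment-reverse-∷ z zs) ⟩
    z + sum zs + moment zs + (moment (reverse zs) + suc (length zs) * z)
  ≡⟨ ring₁ z (sum zs) (moment zs) (moment (reverse zs)) (length zs) ⟩
    z + sum zs + suc (length zs) * z + (moment zs + moment (reverse zs))
  ≡⟨ cong (z + sum zs + suc (length zs) * z +_) (moment+moment-reverse zs) ⟩
    z + sum zs + suc (length zs) * z + suc (length zs) * sum zs
  ≡⟨ ring₂ z (sum zs) (length zs) ⟩
    suc (suc (length zs)) * (z + sum zs)
  ∎
  where
  open ≡-Reasoning
  ring₁ : ∀ z s m m′ n → z + s + m + (m′ + suc n * z) ≡ z + s + suc n * z + (m + m′)
  ring₁ = solve-∀
  ring₂ : ∀ z s n → z + s + suc n * z + suc n * s ≡ suc (suc n) * (z + s)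
  ring₂ = solve-∀

cutQ-∷ʳ : ∀ ys y → cutQ (ys ∷ʳ y) ≡ y * moment (reverse ys) + cutQ ys
cutQ-∷ʳ []       y = cong (λ r → y * r + 0) (m+n∸m≡n y 0)
cutQ-∷ʳ (z ∷ zs) y = begin
    cutQ (z ∷ (zs ∷ʳ y))
  ≡⟨ cutQ-∷ z (zs ∷ʳ y) ⟩
    z * moment (zs ∷ʳ y) + cutQ (zs ∷ʳ y)
  ≡⟨ cong₂ (λ m c → z * m + c) (moment-∷ʳ zs y) (cutQ-∷ʳ zs y) ⟩
    z * (moment zs + suc (length zs) * y) + (y * moment (reverse zs) + cutQ zs)
  ≡⟨ ring z y (moment zs) (moment (reverse zs)) (length zs) (cutQ zs) ⟩
    y * (moment (reverse zs) + suc (length zs) * z) + (z * moment zs + cutQ zs)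
  ≡⟨ cong₂ (λ m c → y * m + c) (sym (moment-reverse-∷ z zs)) (sym (cutQ-∷ z zs)) ⟩
    y * moment (reverse (z ∷ zs)) + cutQ (z ∷ zs)
  ∎
  where
  open ≡-Reasoning
  ring : ∀ z y m m′ n c → z * (m + suc n * y) + (y * m′ + c) ≡ y * (m′ + suc n * z) + (z * m + c)
  ring = solve-∀

cutQ-reverse : ∀ x → cutQ (reverse x) ≡ cutQ x
cutQ-reverse []       = refl
cutQ-reverse (y ∷ ys) = begin
    cutQ (reverse (y ∷ ys))                            ≡⟨ cong cutQ (unfold-reverse y ys) ⟩
    cutQ (reverse ys ∷ʳ y)                             ≡⟨ cutQ-∷ʳ (reverse ys) y ⟩
    y * moment (reverse (reverse ys)) + cutQ (reverse ys)
      ≡⟨ cong₂ (λ r c → y * moment r + c) (reverse-involutive ys) (cutQ-reverse ys) ⟩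
    y * moment ys + cutQ ys                            ≡⟨ sym (cutQ-∷ y ys) ⟩
    cutQ (y ∷ ys)                                      ∎
  where open ≡-Reasoning

cutQ-wrap : ∀ M y → cutQ (M ∷ (y ∷ʳ M)) ≡ M * (suc (length y) * (sum y + M)) + cutQ y
cutQ-wrap M y = begin
    cutQ (M ∷ (y ∷ʳ M))
  ≡⟨ cutQ-∷ M (y ∷ʳ M) ⟩
    M * moment (y ∷ʳ M) + cutQ (y ∷ʳ M)
  ≡⟨ cong₂ (λ m c → M * m + c) (moment-∷ʳ y M) (cutQ-∷ʳ y M) ⟩
    M * (moment y + suc n * M) + (M * moment (reverse y) + cutQ y)
  ≡⟨ ring M (moment y) (moment (reverse y)) (suc n) (cutQ y) ⟩
    M * (moment y + moment (reverse y) + suc n * M) + cutQ y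
  ≡⟨ cong (λ m → M * (m + suc n * M) + cutQ y) (moment+moment-reverse y) ⟩
    M * (suc n * sum y + suc n * M) + cutQ y
  ≡⟨ cong (λ m → M * m + cutQ y) (sym (*-distribˡ-+ (suc n) (sum y) M)) ⟩
    M * (suc n * (sum y + M)) + cutQ y
  ∎
  where
  open ≡-Reasoning
  n : ℕ
  n = length y
  ring : ∀ M m m′ k c → M * (m + k * M) + (M * m′ + c) ≡ M * (m + m′ + k * M) + c
  ring = solve-∀

positioned : ℕ → List ℕ → List (ℕ × ℕ)
positioned k []       = []
positioned k (y ∷ ys) = (k , y) ∷ positioned (suc k) ys

zip-applyUpTo : ∀ f k x → (∀ i → f i ≡ k + i) → zip (applyUpTo f (length x)) x ≡ positioned k x
zip-applyUpTo f k []       f≗k+ = refl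
zip-applyUpTo f k (y ∷ ys) f≗k+ = cong₂ _∷_
  (cong (_, y) (trans (f≗k+ 0) (+-identityʳ k)))
  (zip-applyUpTo (λ i → f (suc i)) (suc k) ys (λ i → trans (f≗k+ (suc i)) (+-suc k i)))

distanceSum : ℕ → List (ℕ × ℕ) → ℕ
distanceSum i []            = 0
distanceSum i ((j , b) ∷ L) = ∣ i - j ∣ * b + distanceSum i L

crossSum : List (ℕ × ℕ) → List (ℕ × ℕ) → ℕ
crossSum []            L′ = 0
crossSum ((i , a) ∷ L) L′ = a * distanceSum i L′ + crossSum L L′

rowSum≡distanceSum : ∀ i a L → sum (map (λ { (j , b) → ∣ i - j ∣ * a * b }) L) ≡ a * distanceSum i L
rowSum≡distanceSum i a []            = sym (*-zeroʳ a)
rowSum≡distanceSum i a ((j , b) ∷ L) = begin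
    ∣ i - j ∣ * a * b + sum (map (λ { (j , b) → ∣ i - j ∣ * a * b }) L)
  ≡⟨ cong (∣ i - j ∣ * a * b +_) (rowSum≡distanceSum i a L) ⟩
    ∣ i - j ∣ * a * b + a * distanceSum i L
  ≡⟨ ring ∣ i - j ∣ a b (distanceSum i L) ⟩
    a * (∣ i - j ∣ * b + distanceSum i L)
  ∎
  where
  open ≡-Reasoning
  ring : ∀ d a b r → d * a * b + a * r ≡ a * (d * b + r)
  ring = solve-∀

doubleSum≡crossSum : ∀ L L′ →
  sum (map (λ { (i , a) → sum (map (λ { (j , b) → ∣ i - j ∣ * a * b }) L′) }) L) ≡ crossSum L L′
doubleSum≡crossSum []            L′ = refl
doubleSum≡crossSum ((i , a) ∷ L) L′ = cong₂ _+_ (rowSum≡distanceSum i a L′) (doubleSum≡crossSum L L′)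

crossSum-∷ : ∀ L j b L′ → crossSum L ((j , b) ∷ L′) ≡ b * distanceSum j L + crossSum L L′
crossSum-∷ []            j b L′ = sym (trans (+-identityʳ (b * 0)) (*-zeroʳ b))
crossSum-∷ ((i , a) ∷ L) j b L′ = begin
    a * (∣ i - j ∣ * b + distanceSum i L′) + crossSum L ((j , b) ∷ L′)
  ≡⟨ cong₂ (λ d c → a * (d * b + distanceSum i L′) + c) (∣-∣-comm i j) (crossSum-∷ L j b L′) ⟩
    a * (∣ j - i ∣ * b + distanceSum i L′) + (b * distanceSum j L + crossSum L L′)
  ≡⟨ ring a b ∣ j - i ∣ (distanceSum i L′) (distanceSum j L) (crossSum L L′) ⟩
    b * (∣ j - i ∣ * a + distanceSum j L) + (a * distanceSum i L′ + crossSum L L′)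
  ∎
  where
  open ≡-Reasoning
  ring : ∀ a b d r r′ c → a * (d * b + r) + (b * r′ + c) ≡ b * (d * a + r′) + (a * r + c)
  ring = solve-∀

distanceSum-positioned : ∀ k d ys {j} → j ≡ k + suc d →
                         distanceSum k (positioned j ys) ≡ d * sum ys + moment ys
distanceSum-positioned k d []       refl = sym (trans (+-identityʳ (d * 0)) (*-zeroʳ d))
distanceSum-positioned k d (y ∷ ys) refl = begin
    ∣ k - k + suc d ∣ * y + distanceSum k (positioned (suc (k + suc d)) ys)
  ≡⟨ cong₂ (λ e r → e * y + r) (∣m-m+n∣≡n k (suc d)) (distanceSum-positioned k (suc d) ys (sym (+-suc k (suc d)))) ⟩
    suc d * y + (suc d * sum ys + moment ys)
  ≡⟨ ring d y (sum ys) (moment ys) ⟩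
    d * (y + sum ys) + (y + sum ys + moment ys)
  ∎
  where
  open ≡-Reasoning
  ring : ∀ d y s m → suc d * y + (suc d * s + m) ≡ d * (y + s) + (y + s + m)
  ring = solve-∀

crossSum-positioned : ∀ k x → crossSum (positioned k x) (positioned k x) ≡ 2 * cutQ x
crossSum-positioned k []       = refl
crossSum-positioned k (y ∷ ys) = begin
    y * (∣ k - k ∣ * y + distanceSum k P) + crossSum P ((k , y) ∷ P)
  ≡⟨ cong₂ (λ e c → y * (e * y + distanceSum k P) + c) (∣n-n∣≡0 k) (crossSum-∷ P k y P) ⟩
    y * distanceSum k P + (y * distanceSum k P + crossSum P P)
  ≡⟨ cong₂ (λ r c → y * r + (y * r + c)) (distanceSum-positioned k 0 ys (sym (+-comm k 1))) (crossSum-positioned (suc k) ys) ⟩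
    y * moment ys + (y * moment ys + 2 * cutQ ys)
  ≡⟨ ring y (moment ys) (cutQ ys) ⟩
    2 * (y * moment ys + cutQ ys)
  ≡⟨ cong (2 *_) (sym (cutQ-∷ y ys)) ⟩
    2 * cutQ (y ∷ ys)
  ∎
  where
  open ≡-Reasoning
  P : List (ℕ × ℕ)
  P = positioned (suc k) ys
  ring : ∀ y m c → y * m + (y * m + 2 * c) ≡ 2 * (y * m + c)
  ring = solve-∀

q≡cutQ : ∀ x → q x ≡ cutQ x
q≡cutQ x = begin
    twiceQ x / 2
  ≡⟨ cong (_/ 2) (doubleSum≡crossSum (indexed x) (indexed x)) ⟩
    crossSum (indexed x) (indexed x) / 2
  ≡⟨ cong (λ L → crossSum L L / 2) (zip-applyUpTo (λ i → i) 0 x (λ i → refl)) ⟩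
    crossSum (positioned 0 x) (positioned 0 x) / 2
  ≡⟨ cong (_/ 2) (trans (crossSum-positioned 0 x) (*-comm 2 (cutQ x))) ⟩
    cutQ x * 2 / 2
  ≡⟨ m*n/n≡m (cutQ x) 2 ⟩
    cutQ x
  ∎
  where open ≡-Reasoning

-- Concavity of the cut product and exchange arguments

cutProduct-sym : ∀ {T} p w → T ≡ p + w → cutProduct T p ≡ cutProduct T w
cutProduct-sym p w eq = begin
    cutProduct _ p ≡⟨ cutProduct-≡ p w eq ⟩
    p * w          ≡⟨ *-comm p w ⟩
    w * p          ≡⟨ sym (cutProduct-≡ w p (trans eq (+-comm p w))) ⟩
    cutProduct _ w ∎
  where open ≡-Reasoning

cutProduct-gap : ∀ {T p p′} d e → p′ ≡ p + d → T ≡ p + p′ + e →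
                 cutProduct T p + d * e ≡ cutProduct T p′
cutProduct-gap {T} {p} d e refl refl = begin
    cutProduct T p + d * e            ≡⟨ cong (_+ d * e) (cutProduct-≡ p (p + d + e) (ring₁ p d e)) ⟩
    p * (p + d + e) + d * e           ≡⟨ ring₂ p d e ⟩
    (p + d) * (p + e)                 ≡⟨ sym (cutProduct-≡ (p + d) (p + e) (ring₃ p d e)) ⟩
    cutProduct T (p + d)              ∎
  where
  open ≡-Reasoning
  ring₁ : ∀ p d e → p + (p + d) + e ≡ p + (p + d + e)
  ring₁ = solve-∀
  ring₂ : ∀ p d e → p * (p + d + e) + d * e ≡ (p + d) * (p + e)
  ring₂ = solve-∀
  ring₃ : ∀ p d e → p + (p + d) + e ≡ p + d + (p + e)
  ring₃ = solve-∀

cutProduct-mono-≤ : ∀ {T p p′} → p ≤ p′ → p + p′ ≤ T → cutProduct T p ≤ cutProduct T p′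
cutProduct-mono-≤ {T} {p} p≤p′ p+p′≤T
  with d , p+d≡p′ ← m≤n⇒∃[o]m+o≡n p≤p′ | e , p+p′+e≡T ← m≤n⇒∃[o]m+o≡n p+p′≤T =
  ≤-trans (m≤m+n _ (d * e)) (≤-reflexive (cutProduct-gap d e (sym p+d≡p′) (sym p+p′+e≡T)))

cutProduct-mono-< : ∀ {T p p′} → p < p′ → p + p′ < T → cutProduct T p < cutProduct T p′
cutProduct-mono-< {T} {p} {p′} p<p′ p+p′<T
  with d , 1+p+d≡p′ ← m≤n⇒∃[o]m+o≡n p<p′ | e , 1+p+p′+e≡T ← m≤n⇒∃[o]m+o≡n p+p′<T =
  <-≤-trans (m<m+n _ z<s) (≤-reflexive (cutProduct-gap (suc d) (suc e)
    (trans (sym 1+p+d≡p′) (sym (+-suc p d))) (trans (sym 1+p+p′+e≡T) (sym (+-suc (p + p′) e)))))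

cutProduct-antimono-< : ∀ {T p p′} → p′ < p → p ≤ T → T < p + p′ → cutProduct T p < cutProduct T p′
cutProduct-antimono-< {T} {p} {p′} p′<p p≤T T<p+p′ with w , refl ← m≤n⇒∃[o]m+o≡n p≤T =
  subst (_< cutProduct (p + w) p′) (sym (cutProduct-sym p w refl))
    (cutProduct-mono-< (+-cancelˡ-< p w p′ T<p+p′) (subst (w + p′ <_) (+-comm w p) (+-monoʳ-< w p′<p)))

cutSum-mono-≤ : ∀ T {o o′} A → o ≤ o′ → o + o′ + (sum A + sum A) ≤ T → cutSum T o A ≤ cutSum T o′ A
cutSum-mono-≤ T     []      o≤o′ bound = ≤-refl
cutSum-mono-≤ T {o} {o′} (a ∷ A) o≤o′ bound =
  +-mono-≤ (cutProduct-mono-≤ o+a≤o′+a (≤-trans (m≤m+n _ _) bound′)) (cutSum-mono-≤ T A o+a≤o′+a bound′)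
  where
  o+a≤o′+a : o + a ≤ o′ + a
  o+a≤o′+a = +-monoˡ-≤ a o≤o′
  bound′ : o + a + (o′ + a) + (sum A + sum A) ≤ T
  bound′ = ≤-trans (≤-reflexive (ring o o′ a (sum A))) bound
    where
    ring : ∀ o o′ a s → o + a + (o′ + a) + (s + s) ≡ o + o′ + (a + s + (a + s))
    ring = solve-∀

cutSum-swap-< : ∀ T e M A C → e < M → e + M + (sum A + sum A) < T →
                cutSum T 0 (e ∷ A ++ M ∷ C) < cutSum T 0 (M ∷ A ++ e ∷ C)
cutSum-swap-< T e M A C e<M bound = begin-strict
    cutSum T 0 (e ∷ A ++ M ∷ C)
  ≡⟨ cutSum-++ T 0 (e ∷ A) (M ∷ C) ⟩
    cutProduct T e + cutSum T e A + cutSum T (e + sum A) (M ∷ C)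
  <⟨ +-monoˡ-< _ (+-mono-<-≤ (cutProduct-mono-< e<M (≤-<-trans (m≤m+n _ _) bound))
                             (cutSum-mono-≤ T A (<⇒≤ e<M) (<⇒≤ bound))) ⟩
    cutProduct T M + cutSum T M A + cutSum T (e + sum A) (M ∷ C)
  ≡⟨ cong (λ p → cutProduct T M + cutSum T M A + (cutProduct T p + cutSum T p C)) (ring e M (sum A)) ⟩
    cutProduct T M + cutSum T M A + cutSum T (M + sum A) (e ∷ C)
  ≡⟨ sym (cutSum-++ T 0 (M ∷ A) (e ∷ C)) ⟩
    cutSum T 0 (M ∷ A ++ e ∷ C)
  ∎
  where
  open ≤-Reasoning
  ring : ∀ e M s → e + s + M ≡ M + s + e
  ring = solve-∀

-- Moving z to the front of A gains at each entry b of A that it overtakes, whatever the offset o′ at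
-- which this happens.
AdvanceGains : ℕ → ℕ → ℕ → List ℕ → Set
AdvanceGains T o z A = ∀ {o′ b} → b ∈ A → o ≤ o′ → o′ + b ≤ o + sum A →
                       cutProduct T (o′ + b) < cutProduct T (o′ + z)

cutSum-advance-≤ : ∀ T o z A B → AdvanceGains T o z A → cutSum T o (A ++ z ∷ B) ≤ cutSum T o (z ∷ A ++ B)
cutSum-advance-< : ∀ T o z a A B → AdvanceGains T o z (a ∷ A) →
                   cutSum T o (a ∷ A ++ z ∷ B) < cutSum T o (z ∷ a ∷ A ++ B)

cutSum-advance-≤ T o z []      B gains = ≤-refl
cutSum-advance-≤ T o z (a ∷ A) B gains = <⇒≤ (cutSum-advance-< T o z a A B gains)

cutSum-advance-< T o z a A B gains = begin-strict
    cutProduct T (o + a) + cutSum T (o + a) (A ++ z ∷ B)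
  ≤⟨ +-monoʳ-≤ (cutProduct T (o + a)) (cutSum-advance-≤ T (o + a) z A B gains′) ⟩
    cutProduct T (o + a) + (cutProduct T (o + a + z) + cutSum T (o + a + z) (A ++ B))
  <⟨ +-monoˡ-< _ (gains (here refl) ≤-refl (+-monoʳ-≤ o (m≤m+n a (sum A)))) ⟩
    cutProduct T (o + z) + (cutProduct T (o + a + z) + cutSum T (o + a + z) (A ++ B))
  ≡⟨ cong (λ p → cutProduct T (o + z) + (cutProduct T p + cutSum T p (A ++ B))) (xy∙z≈xz∙y o a z) ⟩
    cutProduct T (o + z) + (cutProduct T (o + z + a) + cutSum T (o + z + a) (A ++ B))
  ∎
  where
  open ≤-Reasoning
  gains′ : AdvanceGains T (o + a) z A
  gains′ b∈A o+a≤o′ o′+b≤ =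
    gains (there b∈A) (≤-trans (m≤m+n o a) o+a≤o′) (≤-trans o′+b≤ (≤-reflexive (+-assoc o a (sum A))))

advanceGains-pastMidpoint : ∀ T o z A → All (z <_) A → T < o + o → o + sum A ≤ T → AdvanceGains T o z A
advanceGains-pastMidpoint T o z A z<A T<o+o bound {o′} {b} b∈A o≤o′ o′+b≤ =
  cutProduct-antimono-< (+-monoʳ-< o′ (All.lookup z<A b∈A)) (≤-trans o′+b≤ bound)
    (<-≤-trans T<o+o (+-mono-≤ (≤-trans o≤o′ (m≤m+n o′ b)) (≤-trans o≤o′ (m≤m+n o′ z))))

advanceGains-beforeMidpoint : ∀ z A B → All (0 <_) A → All (_< z) A → sum A ≤ sum B →
                              AdvanceGains (sum (A ++ z ∷ B)) 0 z A
advanceGains-beforeMidpoint z A B 0<A A<z sumA≤sumB {o′} {b} b∈A _ o′+b≤sumA =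
  cutProduct-mono-< (+-monoʳ-< o′ (All.lookup A<z b∈A)) (begin-strict
    o′ + b + (o′ + z)    <⟨ +-mono-≤-< o′+b≤sumA (+-monoˡ-< z o′<sumB) ⟩
    sum A + (sum B + z)  ≡⟨ cong (sum A +_) (+-comm (sum B) z) ⟩
    sum A + (z + sum B)  ≡⟨ sym (sum-++ A (z ∷ B)) ⟩
    sum (A ++ z ∷ B)     ∎)
  where
  open ≤-Reasoning
  o′<sumB : o′ < sum B
  o′<sumB = <-≤-trans (m<m+n o′ (All.lookup 0<A b∈A)) (≤-trans o′+b≤sumA sumA≤sumB)

shiftPastMidpoint : ∀ {T o} l L → T < o + o → o + sum (l ∷ L) ≤ T → T < o + l + (o + l) × o + l + sum L ≤ T
shiftPastMidpoint {o = o} l L T<o+o bound =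
  <-≤-trans T<o+o (+-mono-≤ (m≤m+n o l) (m≤m+n o l)) , ≤-trans (≤-reflexive (+-assoc o l (sum L))) bound

-- With every prefix past the midpoint the cut products decrease, so small entries go first.
cutSum-sorted-max : ∀ T o B L → AllPairs _≤_ L → B ↭ L → T < o + o → o + sum L ≤ T →
                    (cutSum T o B ≤ cutSum T o L) × (cutSum T o B ≡ cutSum T o L → B ≡ L)
cutSum-sorted-max T o B [] [] B↭[] T<o+o bound rewrite ↭-empty-inv B↭[] = ≤-refl , λ _ → refl
cutSum-sorted-max T o B (l ∷ L) (l≤L ∷ sorted) B↭ T<o+o bound
  with firstOccurrence (∈-resp-↭ (↭-sym B↭) (here refl)) | shiftPastMidpoint {o = o} l L T<o+o bound
... | splitAt {xs = []} _ refl B₂ | T<2[o+l] , bound′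
  with ih≤ , ih≡ ← cutSum-sorted-max T (o + l) B₂ L sorted (drop-∷ B↭) T<2[o+l] bound′
  = +-monoʳ-≤ _ ih≤ , λ eq → cong (l ∷_) (ih≡ (+-cancelˡ-≡ _ _ _ eq))
... | splitAt {xs = b ∷ B₁} l∉B₁ refl B₂ | T<2[o+l] , bound′ = <⇒≤ strict , λ eq → ⊥-elim (<⇒≢ strict eq)
  where
  rest↭ : b ∷ B₁ ++ B₂ ↭ L
  rest↭ = drop-mid (b ∷ B₁) [] B↭
  l<B₁ : All (l <_) (b ∷ B₁)
  l<B₁ = All.zipWith (λ (l≤ , l≢) → ≤∧≢⇒< l≤ l≢)
           (++⁻ˡ (b ∷ B₁) (All-resp-↭ (↭-sym rest↭) l≤L) , l∉B₁)
  gains : AdvanceGains T o l (b ∷ B₁)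
  gains = advanceGains-pastMidpoint T o l (b ∷ B₁) l<B₁ T<o+o
    (≤-trans (+-monoʳ-≤ o (sum-++ˡ-≤ (b ∷ B₁) (l ∷ B₂))) (≤-trans (≤-reflexive (cong (o +_) (sum-↭ B↭))) bound))
  strict : cutSum T o (b ∷ B₁ ++ l ∷ B₂) < cutSum T o (l ∷ L)
  strict = <-≤-trans (cutSum-advance-< T o l b B₁ B₂ gains)
    (+-monoʳ-≤ _ (proj₁ (cutSum-sorted-max T (o + l) (b ∷ B₁ ++ B₂) L sorted rest↭ T<2[o+l] bound′)))

-- Optimal arrangements

infix 4 _⊑_
_⊑_ : List ℕ → List ℕ → Set
x ⊑ y = (cutQ x ≤ cutQ y) × (cutQ x ≡ cutQ y → x ≡ y ⊎ x ≡ reverse y)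

<-⊑-trans : ∀ {x y z} → cutQ x < cutQ y → y ⊑ z → x ⊑ z
<-⊑-trans {x} {y} {z} x<y (y≤z , _) = <⇒≤ x<z , λ eq → ⊥-elim (<⇒≢ x<z eq)
  where
  x<z : cutQ x < cutQ z
  x<z = <-≤-trans x<y y≤z

⊑-reverse : ∀ x {y} → reverse x ⊑ y → x ⊑ y
⊑-reverse x {y} (rx≤y , tie) = subst (_≤ cutQ y) (cutQ-reverse x) rx≤y , λ eq → flip (tie (trans (cutQ-reverse x) eq))
  where
  flip : reverse x ≡ y ⊎ reverse x ≡ reverse y → x ≡ y ⊎ x ≡ reverse y
  flip (inj₁ refl) = inj₂ (sym (reverse-involutive x))
  flip (inj₂ eq)   = inj₁ (reverse-injective eq)

⊑-wrap : ∀ M {y z} → length y ≡ length z → sum y ≡ sum z → y ⊑ z → M ∷ (y ∷ʳ M) ⊑ M ∷ (z ∷ʳ M)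
⊑-wrap M {y} {z} len≡ sum≡ (y≤z , tie) =
  subst₂ _≤_ (sym eqy) (sym eqz) (+-monoʳ-≤ c y≤z) ,
  λ eq → wrap (tie (+-cancelˡ-≡ c _ _ (trans (sym eqy) (trans eq eqz))))
  where
  c : ℕ
  c = M * (suc (length z) * (sum z + M))
  eqy : cutQ (M ∷ (y ∷ʳ M)) ≡ c + cutQ y
  eqy = trans (cutQ-wrap M y) (cong₂ (λ n s → M * (suc n * (s + M)) + cutQ y) len≡ sum≡)
  eqz : cutQ (M ∷ (z ∷ʳ M)) ≡ c + cutQ z
  eqz = cutQ-wrap M z
  wrap : y ≡ z ⊎ y ≡ reverse z → M ∷ (y ∷ʳ M) ≡ M ∷ (z ∷ʳ M) ⊎ M ∷ (y ∷ʳ M) ≡ reverse (M ∷ (z ∷ʳ M))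
  wrap (inj₁ refl) = inj₁ refl
  wrap (inj₂ refl) = inj₂ (sym (reverse-wrap M z))

module Arrangement (M : ℕ) (L : List ℕ) (L-sorted : AllPairs _≤_ L) (L-positive : All (0 <_) L)
                   (sumL<M : sum L < M) where

  L<M : All (_< M) L
  L<M = All.tabulate (λ v∈L → ≤-<-trans (∈⇒≤sum v∈L) sumL<M)

  largestFirst-⊑ : ∀ C → C ↭ L → M ∷ C ⊑ M ∷ L
  largestFirst-⊑ C C↭L with C≤L , C≡L ← cutSum-sorted-max (M + sum L) M C L L-sorted C↭L (+-monoʳ-< M sumL<M) ≤-refl =
    subst (_≤ cutQ (M ∷ L)) (sym eqC) (+-monoʳ-≤ _ C≤L) ,
    λ eq → inj₁ (cong (M ∷_) (C≡L (+-cancelˡ-≡ _ _ _ (trans (sym eqC) eq))))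
    where
    T : ℕ
    T = M + sum L
    eqC : cutQ (M ∷ C) ≡ cutProduct T M + cutSum T M C
    eqC = cutQ-at (M ∷ C) (cong (M +_) (sum-↭ C↭L))

  largestInside-⊑ : ∀ A B → A ++ B ↭ L → sum A ≤ sum B → A ++ M ∷ B ⊑ M ∷ L
  largestInside-⊑ []      B B↭L _ = largestFirst-⊑ B B↭L
  largestInside-⊑ (a ∷ A) B aAB↭L sumA≤sumB = <-⊑-trans advance (largestFirst-⊑ (a ∷ A ++ B) aAB↭L)
    where
    aA<M : All (_< M) (a ∷ A)
    aA<M = ++⁻ˡ (a ∷ A) (All-resp-↭ (↭-sym aAB↭L) L<M)
    0<aA : All (0 <_) (a ∷ A)
    0<aA = ++⁻ˡ (a ∷ A) (All-resp-↭ (↭-sym aAB↭L) L-positive)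
    advance : cutQ (a ∷ A ++ M ∷ B) < cutQ (M ∷ a ∷ A ++ B)
    advance = subst (cutQ (a ∷ A ++ M ∷ B) <_) (sym (cutQ-at (M ∷ a ∷ A ++ B) (sum-↭ (↭-sym (shift M (a ∷ A) B)))))
      (cutSum-advance-< _ 0 M a A B (advanceGains-beforeMidpoint M (a ∷ A) B 0<aA aA<M sumA≤sumB))

  largestOnce-⊑ : ∀ x → x ↭ M ∷ L → x ⊑ M ∷ L
  largestOnce-⊑ x x↭ with A , B , refl ← ∈-∃++ (∈-resp-↭ (↭-sym x↭) (here refl)) | sum A ≤? sum B
  ... | yes sumA≤sumB = largestInside-⊑ A B (drop-mid A [] x↭) sumA≤sumB
  ... | no  sumA≰sumB = ⊑-reverse (A ++ M ∷ B) (subst (_⊑ M ∷ L) (sym reverse-split)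
        (largestInside-⊑ (reverse B) (reverse A) BA↭L
          (subst₂ _≤_ (sym (sum-↭ (↭-reverse B))) (sym (sum-↭ (↭-reverse A))) (≰⇒≥ sumA≰sumB))))
    where
    reverse-split : reverse (A ++ M ∷ B) ≡ reverse B ++ M ∷ reverse A
    reverse-split = trans (reverse-++ A (M ∷ B))
      (trans (cong (_++ reverse A) (unfold-reverse M B)) (∷ʳ-++ (reverse B) M (reverse A)))
    BA↭L : reverse B ++ reverse A ↭ L
    BA↭L = ↭-trans (↭-reflexive (sym (reverse-++ A B))) (↭-trans (↭-reverse (A ++ B)) (drop-mid A [] x↭))

  xstar : ℕ → List ℕ
  xstar h = replicate (suc h) M ++ (L ++ replicate h M)

  xstar-suc : ∀ h → xstar (suc h) ≡ M ∷ (xstar h ∷ʳ M)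
  xstar-suc h = cong (M ∷_) (begin
      replicate (suc h) M ++ (L ++ replicate (suc h) M)   ≡⟨ cong (λ r → replicate (suc h) M ++ (L ++ r)) (replicate-∷ʳ h M) ⟩
      replicate (suc h) M ++ (L ++ (replicate h M ∷ʳ M))  ≡⟨ cong (replicate (suc h) M ++_) (sym (++-assoc L (replicate h M) [ M ])) ⟩
      replicate (suc h) M ++ ((L ++ replicate h M) ∷ʳ M)  ≡⟨ sym (++-assoc (replicate (suc h) M) (L ++ replicate h M) [ M ]) ⟩
      xstar h ∷ʳ M                                        ∎)
    where open ≡-Reasoning

  notM? : Decidable (M ≢_)
  notM? y = ¬? (M ≟ y)

  sum-filter-xstar : ∀ h {x} → x ↭ xstar h → sum (filter notM? x) ≡ sum L
  sum-filter-xstar h x↭ = trans (sum-↭ (filter-↭ notM? x↭)) (cong sum (begin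
      filter notM? (xstar h)
    ≡⟨ filter-++ notM? (replicate (suc h) M) (L ++ replicate h M) ⟩
      filter notM? (replicate (suc h) M) ++ filter notM? (L ++ replicate h M)
    ≡⟨ cong₂ _++_ (filter-none notM? (onlyM (suc h))) (filter-++ notM? L (replicate h M)) ⟩
      filter notM? L ++ filter notM? (replicate h M)
    ≡⟨ cong₂ _++_ (filter-all notM? (All.map (λ v<M → >⇒≢ v<M) L<M)) (filter-none notM? (onlyM h)) ⟩
      L ++ []
    ≡⟨ ++-identityʳ L ⟩
      L ∎))
    where
    open ≡-Reasoning
    onlyM : ∀ n → All (λ y → ¬ M ≢ y) (replicate n M)
    onlyM n = replicate⁺ n (λ M≢M → M≢M refl)

  sum-beforeM-≤ : ∀ h {e A C} → e ∷ A ++ M ∷ C ↭ xstar h → M ≢ e → All (M ≢_) A → e + sum A ≤ sum L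
  sum-beforeM-≤ h {e} {A} {C} x↭ M≢e M∉A = begin
      sum (e ∷ A)                                         ≡⟨ cong sum (sym (filter-all notM? (M≢e ∷ M∉A))) ⟩
      sum (filter notM? (e ∷ A))                          ≤⟨ sum-++ˡ-≤ (filter notM? (e ∷ A)) (filter notM? (M ∷ C)) ⟩
      sum (filter notM? (e ∷ A) ++ filter notM? (M ∷ C))  ≡⟨ cong sum (sym (filter-++ notM? (e ∷ A) (M ∷ C))) ⟩
      sum (filter notM? (e ∷ A ++ M ∷ C))                 ≡⟨ sum-filter-xstar h x↭ ⟩
      sum L                                               ∎
    where open ≤-Reasoning

  threeM≤sum-xstar : ∀ h → M + (M + M) ≤ sum (xstar (suc h))
  threeM≤sum-xstar h = +-monoʳ-≤ M (+-monoʳ-≤ M (∈⇒≤sum (∈-++⁺ʳ (replicate h M) (∈-++⁺ʳ L (here refl)))))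

  swapWithFirstM-< : ∀ h e A C → e ∷ A ++ M ∷ C ↭ xstar (suc h) → M ≢ e → All (M ≢_) A →
           cutQ (e ∷ A ++ M ∷ C) < cutQ (M ∷ A ++ e ∷ C)
  swapWithFirstM-< h e A C x↭ M≢e M∉A =
    subst (cutQ (e ∷ A ++ M ∷ C) <_) (sym (cutQ-at (M ∷ A ++ e ∷ C) (sum-↭ (swap-↭ M e A C))))
      (cutSum-swap-< T e M A C (≤-<-trans (≤-trans (m≤m+n e (sum A)) before≤) sumL<M) bound)
    where
    T : ℕ
    T = sum (e ∷ A ++ M ∷ C)
    before≤ : e + sum A ≤ sum L
    before≤ = sum-beforeM-≤ (suc h) x↭ M≢e M∉A
    bound : e + M + (sum A + sum A) < T
    bound = begin-strict
      e + M + (sum A + sum A)          ≤⟨ m≤m+n _ e ⟩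
      e + M + (sum A + sum A) + e      ≡⟨ ring e M (sum A) ⟩
      e + sum A + (e + sum A) + M      ≤⟨ +-monoˡ-≤ M (+-mono-≤ before≤ before≤) ⟩
      sum L + sum L + M                <⟨ +-monoˡ-< M (+-mono-< sumL<M sumL<M) ⟩
      M + M + M                        ≡⟨ +-assoc M M M ⟩
      M + (M + M)                      ≤⟨ threeM≤sum-xstar h ⟩
      sum (xstar (suc h))              ≡⟨ sum-↭ (↭-sym x↭) ⟩
      T                                ∎
      where
      open ≤-Reasoning
      ring : ∀ e M s → e + M + (s + s) + e ≡ e + s + (e + s) + M
      ring = solve-∀

  Maximal : ℕ → Set
  Maximal h = ∀ x → x ↭ xstar h → x ⊑ xstar h

  wrappedInM-⊑ : ∀ h → Maximal h → ∀ y → M ∷ (y ∷ʳ M) ↭ xstar (suc h) → M ∷ (y ∷ʳ M) ⊑ xstar (suc h)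
  wrappedInM-⊑ h max y x↭ =
    subst (M ∷ (y ∷ʳ M) ⊑_) (sym (xstar-suc h)) (⊑-wrap M (↭-length y↭) (sum-↭ y↭) (max y y↭))
    where
    y↭ : y ↭ xstar h
    y↭ = drop-∷ʳ y (xstar h) (drop-∷ (subst (M ∷ (y ∷ʳ M) ↭_) (xstar-suc h) x↭))

  endsWithM-⊑ : ∀ h → Maximal h → ∀ z → z ∷ʳ M ↭ xstar (suc h) → z ∷ʳ M ⊑ xstar (suc h)
  endsWithM-⊑ h max []      x↭ with () ← ↭-length x↭
  endsWithM-⊑ h max (e ∷ w) x↭ with M ≟ e
  ... | yes refl = wrappedInM-⊑ h max w x↭
  ... | no  M≢e  with firstOccurrence (∈-tail M≢e ew↭)
    where
    ew↭ : e ∷ w ↭ M ∷ xstar h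
    ew↭ = drop-∷ʳ (e ∷ w) (M ∷ xstar h) (subst ((e ∷ w) ∷ʳ M ↭_) (xstar-suc h) x↭)
  ... | splitAt {xs = A} M∉A refl C =
    subst (_⊑ xstar (suc h)) (sym split) (<-⊑-trans
      (subst (λ y → cutQ (e ∷ A ++ M ∷ (C ∷ʳ M)) < cutQ y) swapped (swapWithFirstM-< h e A (C ∷ʳ M) x′↭ M≢e M∉A))
      (wrappedInM-⊑ h max (A ++ e ∷ C) (subst (_↭ xstar (suc h)) swapped (↭-trans (swap-↭ M e A (C ∷ʳ M)) x′↭))))
    where
    split : (e ∷ A ++ M ∷ C) ∷ʳ M ≡ e ∷ A ++ M ∷ (C ∷ʳ M)
    split = cong (e ∷_) (++-assoc A (M ∷ C) [ M ])
    swapped : M ∷ A ++ e ∷ (C ∷ʳ M) ≡ M ∷ ((A ++ e ∷ C) ∷ʳ M)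
    swapped = cong (M ∷_) (sym (++-assoc A (e ∷ C) [ M ]))
    x′↭ : e ∷ A ++ M ∷ (C ∷ʳ M) ↭ xstar (suc h)
    x′↭ = subst (_↭ xstar (suc h)) split x↭

  xstar-max : ∀ h → Maximal h
  xstar-max zero x x↭ = subst (x ⊑_) (cong (M ∷_) (sym (++-identityʳ L)))
    (largestOnce-⊑ x (subst (x ↭_) (cong (M ∷_) (++-identityʳ L)) x↭))
  xstar-max (suc h) x x↭ with reverse x in rx≡
  ... | [] with () ← ↭-length (subst (_↭ xstar (suc h)) (reverse-injective {y = []} rx≡) x↭)
  ... | e ∷ w with M ≟ e
  ...   | yes refl =
    subst (_⊑ xstar (suc h)) (sym x≡) (endsWithM-⊑ h (xstar-max h) (reverse w) (subst (_↭ xstar (suc h)) x≡ x↭))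
    where
    x≡ : x ≡ reverse w ∷ʳ M
    x≡ = trans (sym (reverse-involutive x)) (trans (cong reverse rx≡) (unfold-reverse M w))
  ...   | no M≢e with firstOccurrence (∈-tail M≢e (subst (_↭ xstar (suc h)) rx≡ (↭-trans (↭-reverse x) x↭)))
  ...     | splitAt {xs = A} M∉A refl C =
    ⊑-reverse x (subst (_⊑ xstar (suc h)) (sym rx≡) (<-⊑-trans (swapWithFirstM-< h e A C rx↭ M≢e M∉A)
      (⊑-reverse (M ∷ A ++ e ∷ C) (subst (_⊑ xstar (suc h)) (sym (unfold-reverse M (A ++ e ∷ C)))
        (endsWithM-⊑ h (xstar-max h) (reverse (A ++ e ∷ C)) s↭)))))
    where
    rx↭ : e ∷ A ++ M ∷ C ↭ xstar (suc h)
    rx↭ = subst (_↭ xstar (suc h)) rx≡ (↭-trans (↭-reverse x) x↭)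
    s↭ : reverse (A ++ e ∷ C) ∷ʳ M ↭ xstar (suc h)
    s↭ = subst (_↭ xstar (suc h)) (unfold-reverse M (A ++ e ∷ C))
           (↭-trans (↭-reverse (M ∷ A ++ e ∷ C)) (↭-trans (swap-↭ M e A C) rx↭))

map-allFin-suc : ∀ {A : Set} t (f : Fin (suc t) → A) →
                 map f (allFin (suc t)) ≡ f Fin.zero ∷ map (λ i → f (Fin.suc i)) (allFin t)
map-allFin-suc t f = cong (f Fin.zero ∷_) (trans (map-tabulate Fin.suc f) (sym (map-tabulate (λ i → i) (λ i → f (Fin.suc i)))))

blocks-suc : ∀ t a m → blocks (suc t) a m ≡ replicate (m Fin.zero) (a Fin.zero) ++ blocks t (a ∘ Fin.suc) (m ∘ Fin.suc)
blocks-suc t a m = cong concat (map-allFin-suc t (λ i → replicate (m i) (a i)))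

blocks-∷ʳ : ∀ t a m → blocks (suc t) a m ≡ blocks t (a ∘ inject₁) (m ∘ inject₁) ++ replicate (m (fromℕ t)) (a (fromℕ t))
blocks-∷ʳ zero    a m = trans (blocks-suc zero a m) (++-identityʳ _)
blocks-∷ʳ (suc t) a m = begin
    blocks (suc (suc t)) a m
  ≡⟨ blocks-suc (suc t) a m ⟩
    first ++ blocks (suc t) (a ∘ Fin.suc) (m ∘ Fin.suc)
  ≡⟨ cong (first ++_) (blocks-∷ʳ t (a ∘ Fin.suc) (m ∘ Fin.suc)) ⟩
    first ++ (middle ++ last)
  ≡⟨ sym (++-assoc first middle last) ⟩
    (first ++ middle) ++ last
  ≡⟨ cong (_++ last) (sym (blocks-suc t (a ∘ inject₁) (m ∘ inject₁))) ⟩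
    blocks (suc t) (a ∘ inject₁) (m ∘ inject₁) ++ last
  ∎
  where
  open ≡-Reasoning
  first middle last : List ℕ
  first  = replicate (m Fin.zero) (a Fin.zero)
  middle = blocks t (a ∘ Fin.suc ∘ inject₁) (m ∘ Fin.suc ∘ inject₁)
  last   = replicate (m (fromℕ (suc t))) (a (fromℕ (suc t)))

sum-blocks : ∀ t a m → sum (blocks t a m) ≡ sum (map (λ i → m i * a i) (allFin t))
sum-blocks zero    a m = refl
sum-blocks (suc t) a m = begin
    sum (blocks (suc t) a m)
  ≡⟨ cong sum (blocks-suc t a m) ⟩
    sum (replicate (m Fin.zero) (a Fin.zero) ++ blocks t (a ∘ Fin.suc) (m ∘ Fin.suc))
  ≡⟨ sum-++ (replicate (m Fin.zero) (a Fin.zero)) _ ⟩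
    sum (replicate (m Fin.zero) (a Fin.zero)) + sum (blocks t (a ∘ Fin.suc) (m ∘ Fin.suc))
  ≡⟨ cong₂ _+_ (sum-replicate (m Fin.zero) (a Fin.zero)) (sum-blocks t (a ∘ Fin.suc) (m ∘ Fin.suc)) ⟩
    m Fin.zero * a Fin.zero + sum (map (λ i → m (Fin.suc i) * a (Fin.suc i)) (allFin t))
  ≡⟨ cong sum (sym (map-allFin-suc t (λ i → m i * a i))) ⟩
    sum (map (λ i → m i * a i) (allFin (suc t)))
  ∎
  where open ≡-Reasoning

blocks-All : ∀ {P : ℕ → Set} t a m → (∀ i → P (a i)) → All P (blocks t a m)
blocks-All zero    a m Pa = []
blocks-All (suc t) a m Pa = subst (All _) (sym (blocks-suc t a m))
  (++⁺ (replicate⁺ (m Fin.zero) (Pa Fin.zero)) (blocks-All t (a ∘ Fin.suc) (m ∘ Fin.suc) (Pa ∘ Fin.suc)))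

blocks-sorted : ∀ t a m → (∀ i j → i <ᶠ j → a i < a j) → AllPairs _≤_ (blocks t a m)
blocks-sorted zero    a m a-mono = []
blocks-sorted (suc t) a m a-mono = subst (AllPairs _≤_) (sym (blocks-suc t a m))
  (AllPairs.++⁺ (replicate-sorted (m Fin.zero) (a Fin.zero))
    (blocks-sorted t (a ∘ Fin.suc) (m ∘ Fin.suc) (λ i j i<j → a-mono (Fin.suc i) (Fin.suc j) (s≤s i<j)))
    (replicate⁺ (m Fin.zero) (blocks-All t (a ∘ Fin.suc) (m ∘ Fin.suc) (λ i → <⇒≤ (a-mono Fin.zero (Fin.suc i) z<s)))))

theorem3p1 : (t : ℕ) (a m : Fin (suc t) → ℕ) (h : ℕ) (b : List ℕ) →
    1 ≤ length b →
    All (λ v → 1 ≤ v) b →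
    (∀ i j → i <ᶠ j → a i < a j) →
    (∀ i → 1 ≤ m i) →
    b ↭ blocks (suc t) a m →
    sum (map (λ i → m (inject₁ i) * a (inject₁ i)) (allFin t)) < a (fromℕ t) →
    m (fromℕ t) ≡ 2 * h + 1 →
    let xstar = replicate (suc h) (a (fromℕ t)) ++ (blocks t (λ i → a (inject₁ i)) (λ i → m (inject₁ i)) ++ replicate h (a (fromℕ t)))
    in (xstar ↭ b)
       × (∀ x → x ↭ b → q x ≤ q xstar)
       × (∀ x → x ↭ b → q x ≡ q xstar → (x ≡ xstar) ⊎ (x ≡ reverse xstar))
theorem3p1 t a m h b _ b-positive a-mono _ b↭blocks sum<M mₛ≡2h+1 = ↭-sym b↭xstar , bound , tie
  where
  M : ℕ
  M = a (fromℕ t)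
  L : List ℕ
  L = blocks t (λ i → a (inject₁ i)) (λ i → m (inject₁ i))
  blocks≡ : blocks (suc t) a m ≡ L ++ (replicate (suc h) M ++ replicate h M)
  blocks≡ = trans (blocks-∷ʳ t a m)
    (cong (L ++_) (trans (cong (λ n → replicate n M) (trans mₛ≡2h+1 (2h+1≡1+h+h h))) (replicate-+ (suc h) h M)))
    where
    2h+1≡1+h+h : ∀ h → 2 * h + 1 ≡ suc h + h
    2h+1≡1+h+h = solve-∀
  L-positive : All (0 <_) L
  L-positive = ++⁻ˡ L (subst (All (0 <_)) blocks≡ (All-resp-↭ b↭blocks b-positive))
  L-sorted : AllPairs _≤_ L
  L-sorted = blocks-sorted t _ _ λ i j i<j →
    a-mono (inject₁ i) (inject₁ j) (subst₂ _<_ (sym (toℕ-inject₁ i)) (sym (toℕ-inject₁ j)) i<j)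
  open Arrangement M L L-sorted L-positive (subst (_< M) (sym (sum-blocks t _ _)) sum<M)
  b↭xstar : b ↭ xstar h
  b↭xstar = ↭-trans b↭blocks (↭-trans (↭-reflexive blocks≡) (↭-sym (shifts (replicate (suc h) M) L)))
  maximal : ∀ x → x ↭ b → x ⊑ xstar h
  maximal x x↭b = xstar-max h x (↭-trans x↭b b↭xstar)
  bound : ∀ x → x ↭ b → q x ≤ q (xstar h)
  bound x x↭b = subst₂ _≤_ (sym (q≡cutQ x)) (sym (q≡cutQ (xstar h))) (proj₁ (maximal x x↭b))
  tie : ∀ x → x ↭ b → q x ≡ q (xstar h) → x ≡ xstar h ⊎ x ≡ reverse (xstar h)
  tie x x↭b eq = proj₂ (maximal x x↭b) (trans (sym (q≡cutQ x)) (trans eq (q≡cutQ (xstar h))))
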